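{- Let $f:\{0,1\}^n\to\{0,1\}$ have certificate complexity $k$. If $\mathrm{Var}(f)<2^{ -k}-2^{ -2k}$, then $\mathrm{Var}(f)=0$, i.e. $f$ is constant.
   Context: $\mathrm{Var}(f)=\Pr_x[f(x)=0]\cdot\Pr_x[f(x)=1]$ for uniform $x\in\{0,1\}^n$. The certificate complexity of $f$ is the maximum over $x$ of the minimum size of a set $S\subseteq[n]$ such that $f(y)=f(x)$ for all $y$ agreeing with $x$ on $S$. -}

module Defs where

open import Data.Nat using (ℕ; zero; suc; _+_; _*_; _∸_; _^_; _≤_; _<_)
open import Data.Bool using (Bool; true; false; if_then_else_)
open import Data.Fin using (Fin)
open import Data.Fin.Subset using (Subset; _∈_; ∣_∣)
open import Data.Vec.Functional using () renaming (_∷_ to _∷ᶠ_)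
open import Data.Product using (Σ; _×_; ∃)
open import Relation.Binary.PropositionalEquality using (_≡_)
open import Relation.Nullary using (¬_)

Cube : ℕ → Set
Cube n = Fin n → Bool

BoolFun : ℕ → Set
BoolFun n = Cube n → Bool

AgreeOn : ∀ {n} → Subset n → Cube n → Cube n → Set
AgreeOn S x y = ∀ i → i ∈ S → x i ≡ y i

IsCertificate : ∀ {n} → BoolFun n → Cube n → Subset n → Set
IsCertificate f x S = ∀ y → AgreeOn S x y → f y ≡ f x

-- C(f,x) = min size of a certificate at x;  C(f) = max_x C(f,x).
-- "C(f) = k" unfolds to: every x has a certificate of size ≤ k,
-- and some x has no certificate of size < k.
HasCertOfSize≤ : ∀ {n} → BoolFun n → Cube n → ℕ → Set
HasCertOfSize≤ f x k = Σ (Subset _) λ S → IsCertificate f x S × ∣ S ∣ ≤ k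

CertComplexity≡ : ∀ {n} → BoolFun n → ℕ → Set
CertComplexity≡ {n} f k =
  (∀ (x : Cube n) → HasCertOfSize≤ f x k) ×
  Σ (Cube n) λ x → ∀ (S : Subset n) → IsCertificate f x S → k ≤ ∣ S ∣

count1 : ∀ n → BoolFun n → ℕ
count1 zero f = if f (λ ()) then 1 else 0
count1 (suc n) f = count1 n (λ x → f (true ∷ᶠ x)) + count1 n (λ x → f (false ∷ᶠ x))

count0 : ∀ n → BoolFun n → ℕ
count0 n f = 2 ^ n ∸ count1 n f

-- Var(f) = Pr[f=0]·Pr[f=1] = count0·count1 / 4^n.  We represent the
-- rational Var(f) by its numerator over the fixed denominator 4^n.
varNum : ∀ n → BoolFun n → ℕ
varNum n f = count0 n f * count1 n f

-- If f is not constant, take x with f x = true and a certificate S at x of size at most k: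
-- f is true on the whole subcube of points agreeing with x on S, so it has at least
-- 2^(n-k) true points, and symmetrically at least 2^(n-k) false points.  With a + b = 2^n
-- and a, b ≥ 2^(n-k), the product ab is at least 2^(n-k)(2^n - 2^(n-k)), which is exactly
-- 4^n (2^(-k) - 2^(-2k)).
module Submission where

open import Defs
open import Data.Nat using (ℕ; _*_; _^_; _∸_; _<_)
open import Relation.Binary.PropositionalEquality using (_≡_)

open import Data.Nat using (zero; suc; _+_; _≤_; _≟_)
open import Data.Nat.Properties
open import Data.Nat.Tactic.RingSolver using (solve-∀)
open import Data.Bool using (Bool; true; false; not; if_then_else_)
open import Data.Fin using () renaming (zero to fzero; suc to fsuc)
open import Data.Fin.Subset using (Subset; ∣_∣)
open import Data.Vec using ([]; _∷_; here; there)
open import Data.Vec.Functional using (head; tail) renaming (_∷_ to _∷ᶠ_)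
open import Data.Product using (Σ; _,_)
open import Data.Empty using (⊥-elim)
open import Function using (_∘_)
open import Relation.Nullary using (¬_; yes; no)
open import Relation.Binary.PropositionalEquality using (refl; sym; trans; cong; cong₂; subst; module ≡-Reasoning)

restrict : ∀ {n} → BoolFun (suc n) → Bool → BoolFun n
restrict g b y = g (b ∷ᶠ y)

count1-restrict≤count1 : ∀ n (g : BoolFun (suc n)) b → count1 n (restrict g b) ≤ count1 (suc n) g
count1-restrict≤count1 n g true  = m≤m+n _ _
count1-restrict≤count1 n g false = m≤n+m _ _

count1+count1-not≡2^n : ∀ n (g : BoolFun n) → count1 n g + count1 n (not ∘ g) ≡ 2 ^ n
count1+count1-not≡2^n zero g = indicator+indicator-not≡1 (g _)
  where
  indicator+indicator-not≡1 : ∀ b → (if b then 1 else 0) + (if not b then 1 else 0) ≡ 1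
  indicator+indicator-not≡1 true  = refl
  indicator+indicator-not≡1 false = refl
count1+count1-not≡2^n (suc n) g = begin
  (c true + c false) + (c̄ true + c̄ false) ≡⟨ interchange (c true) (c false) (c̄ true) (c̄ false) ⟩
  (c true + c̄ true) + (c false + c̄ false) ≡⟨ cong₂ _+_ (halves true) (halves false) ⟩
  2 ^ n + 2 ^ n                            ≡⟨ cong (2 ^ n +_) (sym (+-identityʳ (2 ^ n))) ⟩
  2 ^ suc n                                ∎
  where
  open ≡-Reasoning
  c c̄ : Bool → ℕ
  c b = count1 n (restrict g b)
  c̄ b = count1 n (not ∘ restrict g b)
  halves : ∀ b → c b + c̄ b ≡ 2 ^ n
  halves b = count1+count1-not≡2^n n (restrict g b)
  interchange : ∀ a b c d → (a + b) + (c + d) ≡ (a + c) + (b + d)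
  interchange = solve-∀

count0≡count1-not : ∀ n (g : BoolFun n) → count0 n g ≡ count1 n (not ∘ g)
count0≡count1-not n g =
  trans (cong (_∸ count1 n g) (sym (count1+count1-not≡2^n n g))) (m+n∸m≡n (count1 n g) _)

count1≢0⇒∃true : ∀ n (g : BoolFun n) → ¬ count1 n g ≡ 0 → Σ (Cube n) λ x → g x ≡ true
count1≢0⇒∃true zero g c≢0 = _ , indicator≢0⇒true (g _) c≢0
  where
  indicator≢0⇒true : ∀ b → ¬ (if b then 1 else 0) ≡ 0 → b ≡ true
  indicator≢0⇒true true  _   = refl
  indicator≢0⇒true false b≢0 = ⊥-elim (b≢0 refl)
count1≢0⇒∃true (suc n) g c≢0 with count1 n (restrict g true) ≟ 0
... | no ct≢0 with count1≢0⇒∃true n (restrict g true) ct≢0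
...   | x , gx = true ∷ᶠ x , gx
count1≢0⇒∃true (suc n) g c≢0 | yes ct≡0
  with count1≢0⇒∃true n (restrict g false) (λ cf≡0 → c≢0 (cong₂ _+_ ct≡0 cf≡0))
...   | x , gx = false ∷ᶠ x , gx

TrueOnSubcube : ∀ {n} → BoolFun n → Subset n → Cube n → Set
TrueOnSubcube g S x = ∀ y → AgreeOn S x y → g y ≡ true

-- A free coordinate (s = false) may be fixed to any b; a fixed one only to head x.
TrueOnSubcube-restrict : ∀ {n} {g : BoolFun (suc n)} {s S x} b → (s ≡ true → head x ≡ b) →
  TrueOnSubcube g (s ∷ S) x → TrueOnSubcube (restrict g b) S (tail x)
TrueOnSubcube-restrict {x = x} b fixed gS y agree = gS (b ∷ᶠ y) agree′
  where
  agree′ : AgreeOn _ x (b ∷ᶠ y)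
  agree′ fzero     here      = fixed refl
  agree′ (fsuc i) (there i∈S) = agree i i∈S

TrueOnSubcube⇒2^n≤count1*2^∣S∣ : ∀ n (g : BoolFun n) S x → TrueOnSubcube g S x →
  2 ^ n ≤ count1 n g * 2 ^ ∣ S ∣
TrueOnSubcube⇒2^n≤count1*2^∣S∣ zero g [] x gS = indicator-true (g _) (gS _ (λ ()))
  where
  indicator-true : ∀ b → b ≡ true → 1 ≤ (if b then 1 else 0) * 1
  indicator-true true _ = ≤-refl
TrueOnSubcube⇒2^n≤count1*2^∣S∣ (suc n) g (true ∷ S) x gS = begin
  2 * 2 ^ n                         ≤⟨ *-monoʳ-≤ 2 restricted ⟩
  2 * (count1 n g₀ * 2 ^ ∣ S ∣)      ≡⟨ *-swap 2 (count1 n g₀) (2 ^ ∣ S ∣) ⟩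
  count1 n g₀ * (2 * 2 ^ ∣ S ∣)      ≤⟨ *-monoˡ-≤ _ (count1-restrict≤count1 n g (head x)) ⟩
  count1 (suc n) g * 2 ^ suc ∣ S ∣   ∎
  where
  open ≤-Reasoning
  g₀ : BoolFun n
  g₀ = restrict g (head x)
  restricted : 2 ^ n ≤ count1 n g₀ * 2 ^ ∣ S ∣
  restricted = TrueOnSubcube⇒2^n≤count1*2^∣S∣ n g₀ S (tail x)
    (TrueOnSubcube-restrict (head x) (λ _ → refl) gS)
  *-swap : ∀ a b c → a * (b * c) ≡ b * (a * c)
  *-swap = solve-∀
TrueOnSubcube⇒2^n≤count1*2^∣S∣ (suc n) g (false ∷ S) x gS = begin
  2 ^ n + (2 ^ n + 0)                           ≡⟨ cong (2 ^ n +_) (+-identityʳ (2 ^ n)) ⟩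
  2 ^ n + 2 ^ n                                 ≤⟨ +-mono-≤ (restricted true) (restricted false) ⟩
  count1 n (restrict g true) * 2 ^ ∣ S ∣ + count1 n (restrict g false) * 2 ^ ∣ S ∣
    ≡⟨ *-distribʳ-+ (2 ^ ∣ S ∣) (count1 n (restrict g true)) (count1 n (restrict g false)) ⟨
  count1 (suc n) g * 2 ^ ∣ S ∣                  ∎
  where
  open ≤-Reasoning
  restricted : ∀ b → 2 ^ n ≤ count1 n (restrict g b) * 2 ^ ∣ S ∣
  restricted b = TrueOnSubcube⇒2^n≤count1*2^∣S∣ n (restrict g b) S (tail x)
    (TrueOnSubcube-restrict b (λ ()) gS)

HasCertOfSize≤-not : ∀ {n} {g : BoolFun n} {x k} → HasCertOfSize≤ g x k → HasCertOfSize≤ (not ∘ g) x k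
HasCertOfSize≤-not (S , cert , ∣S∣≤k) = S , (λ y agree → cong not (cert y agree)) , ∣S∣≤k

certificates⇒2^n≤count1*2^k : ∀ n k (g : BoolFun n) → (∀ x → HasCertOfSize≤ g x k) →
  ¬ count1 n g ≡ 0 → 2 ^ n ≤ count1 n g * 2 ^ k
certificates⇒2^n≤count1*2^k n k g certs c≢0 with count1≢0⇒∃true n g c≢0
... | x , gx with certs x
...   | S , cert , ∣S∣≤k =
  ≤-trans (TrueOnSubcube⇒2^n≤count1*2^∣S∣ n g S x (λ y agree → trans (cert y agree) gx))
          (*-monoʳ-≤ (count1 n g) (^-monoʳ-≤ 2 ∣S∣≤k))

-- (aK - N)(bK - N) ≥ 0 together with a + b = N, written without subtraction.
large-parts⇒product-bound : ∀ a b K N → N ≤ a * K → N ≤ b * K → a + b ≡ N →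
  (K ∸ 1) * (N * N) ≤ (b * a) * (K * K)
large-parts⇒product-bound a b K N N≤aK N≤bK a+b≡N
  with m≤n⇒∃[o]m+o≡n N≤aK | m≤n⇒∃[o]m+o≡n N≤bK
... | u , N+u≡aK | v , N+v≡bK = begin
  (K ∸ 1) * (N * N)          ≡⟨ *-distribʳ-∸ (N * N) K 1 ⟩
  K * (N * N) ∸ 1 * (N * N)  ≤⟨ m≤n+o⇒m∸n≤o (K * (N * N)) (1 * (N * N)) KN²≤ ⟩
  (b * a) * (K * K)          ∎
  where
  open ≤-Reasoning
  KN²≤ : K * (N * N) ≤ 1 * (N * N) + (b * a) * (K * K)
  KN²≤ = begin
    K * (N * N)                              ≡⟨ cong (λ m → K * (N * m)) a+b≡N ⟨
    K * (N * (a + b))                        ≡⟨ spread N a b K ⟩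
    N * (a * K + b * K)                      ≡⟨ cong (λ m → N * m) (cong₂ _+_ N+u≡aK N+v≡bK) ⟨
    N * ((N + u) + (N + v))                  ≡⟨ expand₁ N u v ⟩
    1 * (N * N) + (N * N + N * u + N * v)    ≤⟨ +-monoʳ-≤ (1 * (N * N)) (m≤m+n _ (u * v)) ⟩
    1 * (N * N) + (N * N + N * u + N * v + u * v) ≡⟨ cong (1 * (N * N) +_) (expand₂ N u v) ⟩
    1 * (N * N) + (N + u) * (N + v)          ≡⟨ cong (λ m → 1 * (N * N) + m) (cong₂ _*_ N+u≡aK N+v≡bK) ⟩
    1 * (N * N) + (a * K) * (b * K)          ≡⟨ cong (1 * (N * N) +_) (regroup a b K) ⟩
    1 * (N * N) + (b * a) * (K * K)          ∎
    where
    spread : ∀ N a b K → K * (N * (a + b)) ≡ N * (a * K + b * K)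
    spread = solve-∀
    expand₁ : ∀ N u v → N * ((N + u) + (N + v)) ≡ 1 * (N * N) + (N * N + N * u + N * v)
    expand₁ = solve-∀
    expand₂ : ∀ N u v → N * N + N * u + N * v + u * v ≡ (N + u) * (N + v)
    expand₂ = solve-∀
    regroup : ∀ a b K → (a * K) * (b * K) ≡ (b * a) * (K * K)
    regroup = solve-∀

4^n≡2^n*2^n : ∀ n → 4 ^ n ≡ 2 ^ n * 2 ^ n
4^n≡2^n*2^n zero    = refl
4^n≡2^n*2^n (suc n) = trans (cong (4 *_) (4^n≡2^n*2^n n)) (square-double (2 ^ n))
  where
  square-double : ∀ m → 4 * (m * m) ≡ (2 * m) * (2 * m)
  square-double = solve-∀

nonconstant⇒varNum-bound : ∀ n k (f : BoolFun n) → (∀ x → HasCertOfSize≤ f x k) →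
  ¬ count1 n f ≡ 0 → ¬ count0 n f ≡ 0 → (2 ^ k ∸ 1) * 4 ^ n ≤ varNum n f * 4 ^ k
nonconstant⇒varNum-bound n k f certs c1≢0 c0≢0 = begin
  (2 ^ k ∸ 1) * 4 ^ n                   ≡⟨ cong ((2 ^ k ∸ 1) *_) (4^n≡2^n*2^n n) ⟩
  (2 ^ k ∸ 1) * (2 ^ n * 2 ^ n)
    ≤⟨ large-parts⇒product-bound (count1 n f) (count0 n f) (2 ^ k) (2 ^ n) trues falses total ⟩
  varNum n f * (2 ^ k * 2 ^ k)          ≡⟨ cong (varNum n f *_) (4^n≡2^n*2^n k) ⟨
  varNum n f * 4 ^ k                    ∎
  where
  open ≤-Reasoning
  c0≡c̄1 : count0 n f ≡ count1 n (not ∘ f)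
  c0≡c̄1 = count0≡count1-not n f
  trues : 2 ^ n ≤ count1 n f * 2 ^ k
  trues = certificates⇒2^n≤count1*2^k n k f certs c1≢0
  falses : 2 ^ n ≤ count0 n f * 2 ^ k
  falses = subst (λ m → 2 ^ n ≤ m * 2 ^ k) (sym c0≡c̄1)
    (certificates⇒2^n≤count1*2^k n k (not ∘ f) (HasCertOfSize≤-not ∘ certs) (c0≢0 ∘ trans c0≡c̄1))
  total : count1 n f + count0 n f ≡ 2 ^ n
  total = trans (cong (count1 n f +_) c0≡c̄1) (count1+count1-not≡2^n n f)

fact5p11 : (n k : ℕ) (f : BoolFun n) → CertComplexity≡ f k →
    varNum n f * 4 ^ k < (2 ^ k ∸ 1) * 4 ^ n → varNum n f ≡ 0
fact5p11 n k f (certs , _) var<bound with count1 n f ≟ 0 | count0 n f ≟ 0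
... | yes c1≡0 | _        = trans (cong (count0 n f *_) c1≡0) (*-zeroʳ (count0 n f))
... | no _     | yes c0≡0 = cong (_* count1 n f) c0≡0
... | no c1≢0  | no c0≢0  =
  ⊥-elim (<⇒≱ var<bound (nonconstant⇒varNum-bound n k f certs c1≢0 c0≢0))
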